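{- Let $G=(V,E)$ be a finite simple undirected graph, and run on $G$ the recursive procedure $\mathrm{FC}_2$ described in the context. Then the procedure terminates, and upon termination the following hold. (i) For every vertex $v\in V$, every set in the list $a_v$ is a clique of $G$ containing $v$. Moreover, for any two distinct sets $S_i,S_j$ in $a_v$ we have $v\in S_i\cap S_j$, $S_i\not\subseteq S_j$ and $S_i\not\supseteq S_j$. (ii) A set of maximum cardinality among all sets in $\bigcup_{v\in V} a_v$ is a maximum clique of $G$.
   Context: For a graph $G$ and a vertex $v$, $N(v)$ is the set of neighbors of $v$ in $G$; a clique is a set of pairwise adjacent vertices, and a maximum clique is a clique of largest cardinality. Each vertex $v$ carries a list $a_v$ of vertex sets. Procedure $\mathrm{FC}_2(G)$, on a graph $G=(V,E)$: (1) Choose an arbitrary vertex $v\in V$, and let $M=N(v)$, computed in $G$. (2) Let $G'$ be the graph with vertex set $V\setminus\{v\}$ and edge set $E$ minus all edges incident to $v$. Set $a_v\leftarrow$ the empty list. (3) If $G'$ is nonempty, call $\mathrm{FC}_2(G')$, which computes the lists $a_x$ for $x\in V\setminus\{v\}$. Then, for each $x\in M$, do the following. If $a_x$ is empty, set $L=\{v,x\}$ and perform the update below once. Otherwise, for each set $A\in a_x$, set $L=(N(v)\cap A)\cup\{v,x\}$ and perform the update below. The update is as follows. Set $new\leftarrow$ FALSE and $old\leftarrow$ FALSE. For each set $B$ in $a_v$ (or once with $B=\emptyset$ if $a_v$ is empty): - if $|B|<|L|$, then first remove $B$ from $a_v$ if $B\neq\emptyset$ and $B\subset L$, and then set $new\leftarrow$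 TRUE; - otherwise, if $B\not\supseteq L$ set $new\leftarrow$ TRUE, else set $old\leftarrow$ TRUE. After this loop over $B$, if $new$ is TRUE and $old$ is FALSE, append $L$ to $a_v$. (4) Return $G$ together with the lists $a_v$. -}

module Defs where

open import Data.Bool using (Bool; true; false; not; _∧_; _∨_; if_then_else_)
import Data.Bool as Bool
open import Data.Nat using (ℕ; _≤_; _<?_)
open import Data.Fin using (Fin)
import Data.Fin as Fin
open import Data.Fin.Subset using (Subset; _∈_; _⊆_; _⊈_; _∩_; _∪_; ⁅_⁆; ⊥; ∣_∣)
open import Data.Fin.Subset.Properties using (_⊆?_; _⊂?_)
open import Data.Vec using (tabulate; lookup)
open import Data.Vec.Properties using (≡-dec)
open import Data.List using (List; []; _∷_; _++_; foldl; foldr; filterᵇ; map; concatMap; null)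
open import Data.Bool.ListAction using (any)
open import Data.Product using (_×_)
open import Relation.Nullary using (¬_)
open import Relation.Nullary.Decidable using (⌊_⌋)
open import Relation.Binary.PropositionalEquality using (_≡_; _≢_)

record SimpleGraph (n : ℕ) : Set where
  field
    adj    : Fin n → Fin n → Bool
    sym    : ∀ u v → adj u v ≡ adj v u
    irrefl : ∀ v → adj v v ≡ false

open SimpleGraph public

module _ {n : ℕ} (G : SimpleGraph n) where

  IsClique : Subset n → Set
  IsClique S = ∀ u w → u ∈ S → w ∈ S → u ≢ w → adj G u w ≡ true

  IsMaximumClique : Subset n → Set
  IsMaximumClique S = IsClique S × (∀ T → IsClique T → ∣ T ∣ ≤ ∣ S ∣)

  toSubset : List (Fin n) → Subset n
  toSubset = foldr (λ x s → ⁅ x ⁆ ∪ s) ⊥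

  nbr : Subset n → Fin n → Subset n
  nbr R v = tabulate (λ u → adj G v u) ∩ R

  removeB : Subset n → Subset n → Bool
  removeB L B = ⌊ ∣ B ∣ <? ∣ L ∣ ⌋ ∧ (not ⌊ ≡-dec Bool._≟_ B ⊥ ⌋ ∧ ⌊ B ⊂? L ⌋)

  newB : Subset n → Subset n → Bool
  newB L B = ⌊ ∣ B ∣ <? ∣ L ∣ ⌋ ∨ not ⌊ L ⊆? B ⌋

  oldB : Subset n → Subset n → Bool
  oldB L B = not ⌊ ∣ B ∣ <? ∣ L ∣ ⌋ ∧ ⌊ L ⊆? B ⌋

  -- The loop ranges over the sets of
  -- a_v (or once over B = ∅ if a_v is empty); removed sets are dropped,
  -- and L is appended iff new = TRUE and old = FALSE.
  update : List (Subset n) → Subset n → List (Subset n)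
  update av L =
    let bs   = if null av then ⊥ ∷ [] else av
        new  = any (newB L) bs
        old  = any (oldB L) bs
        kept = filterᵇ (λ B → not (removeB L B)) av
    in if new ∧ not old then kept ++ (L ∷ []) else kept

  -- FC₂ run with removal order 'order' (the vertex chosen in step (1) at
  -- each recursion level, in turn) and, for each vertex v, an enumeration
  -- 'iter v' of the vertices fixing the order in which x ∈ M is visited.
  -- The result gives the list a_v for each vertex v.
  FC₂ : List (Fin n) → (Fin n → List (Fin n)) → Fin n → List (Subset n)
  FC₂ []       iter = λ _ → []
  FC₂ (v ∷ vs) iter =
    let a   = FC₂ vs iter
        N   = nbr (toSubset (v ∷ vs)) v
        M   = filterᵇ (λ x → lookup N x) (iter v)
        Ls  = λ x → if null (a x)
                      then (⁅ v ⁆ ∪ ⁅ x ⁆) ∷ []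
                      else map (λ A → (N ∩ A) ∪ (⁅ v ⁆ ∪ ⁅ x ⁆)) (a x)
        av  = foldl update [] (concatMap Ls M)
    in λ u → if ⌊ u Fin.≟ v ⌋ then av else a u

module Submission where

-- Two invariants are maintained along the removal order.  First, each list a_u consists of
-- pairwise ⊆-incomparable cliques through u: an update either finds a stored superset of the
-- candidate L, and then only discards sets strictly inside L, or it discards the proper subsets
-- of L and appends L, which no survivor then contains or is contained in.  Second, every clique
-- K of processed vertices lies in a set stored at one of its own vertices (or K = {x} and a_x is
-- empty).  When v is processed, K ∩ vs is covered by some A ∈ a_z, so K ⊆ (N(v) ∩ A) ∪ {v, z},
-- one of the candidates offered to a_v; and updates never lose coverage, because a discarded set
-- lies inside the set that replaces it.  Applied to a maximum clique, this gives (ii).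

open import Data.Bool using (true; false; not; T; if_then_else_)
import Data.Bool as Bool
open import Data.Bool.Properties using (T?; T-≡)
open import Data.Bool.ListAction using (any)
open import Data.Empty using (⊥-elim)
open import Data.Fin using (Fin; _≟_)
open import Data.Fin.Properties using (any?)
open import Data.Fin.Subset using (Subset; _∈_; _∉_; _⊆_; _⊈_; _⊂_; _∩_; _∪_; ⁅_⁆; ⊥; ∣_∣)
open import Data.Fin.Subset.Properties
open import Data.List using (List; []; _∷_; _++_; [_]; null; map; foldl; filterᵇ; concatMap; allFin)
open import Data.List.Membership.Propositional using (find; lose) renaming (_∈_ to _∈ₗ_)
open import Data.List.Membership.Propositional.Properties
  using (∈-filter⁺; ∈-filter⁻; ∈-map⁺; ∈-map⁻; ∈-concatMap⁺; ∈-concatMap⁻; ∈-++⁺ˡ; ∈-++⁺ʳ; ∈-allFin)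
open import Data.List.Relation.Unary.All as All using (All; []; _∷_)
import Data.List.Relation.Unary.All.Properties as All
open import Data.List.Relation.Unary.AllPairs as AllPairs using (AllPairs; []; _∷_)
import Data.List.Relation.Unary.AllPairs.Properties as AllPairs
open import Data.List.Relation.Unary.Any using (here; there)
open import Data.List.Relation.Unary.Any.Properties using (any⁺; any⁻)
open import Data.List.Relation.Binary.Permutation.Propositional using (_↭_; ↭-sym; ↭⇒↭ₛ)
open import Data.List.Relation.Binary.Permutation.Propositional.Properties using (∈-resp-↭)
import Data.List.Relation.Binary.Permutation.Setoid.Properties as Permutation
open import Data.List.Relation.Unary.Unique.Propositional.Properties using (allFin⁺)
open import Data.Nat using (ℕ; _≤_; _<?_)
open import Data.Nat.Properties using (≤-trans; <⇒≱; module ≤-Reasoning)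
open import Data.Product using (_×_; _,_; proj₁; proj₂; ∃-syntax)
open import Data.Sum using (_⊎_; inj₁; inj₂)
open import Data.Unit using (tt)
open import Data.Vec using (tabulate; lookup)
open import Data.Vec.Properties using (≡-dec; []=⇒lookup; lookup⇒[]=; lookup∘tabulate)
open import Function using (_∘_; id; Equivalence)
open import Relation.Binary.PropositionalEquality using (_≡_; _≢_; refl; sym; trans; subst; setoid)
open import Relation.Nullary using (¬_; yes; no)
open import Relation.Nullary.Decidable using (_×-dec_; ¬?; decidable-stable)

open import Defs renaming (sym to adj-sym)

private
  variable
    n : ℕ
    x v : Fin n
    p q : Subset n

⊈⇒∃∉ : ¬ p ⊆ q → ∃[ x ] x ∈ p × x ∉ q
⊈⇒∃∉ {p = p} {q} p⊈q with any? (λ x → x ∈? p ×-dec ¬? (x ∈? q))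
... | yes witness = witness
... | no none = ⊥-elim (p⊈q λ {x} x∈p → decidable-stable (x ∈? q) (λ x∉q → none (x , x∈p , x∉q)))

x∈p⇒⁅x⁆⊆p : x ∈ p → ⁅ x ⁆ ⊆ p
x∈p⇒⁅x⁆⊆p {p = p} x∈p y∈⁅x⁆ = subst (_∈ p) (sym (x∈⁅y⁆⇒x≡y _ y∈⁅x⁆)) x∈p

x∈⁅y⁆∪⁅z⁆⁻ : ∀ (y z : Fin n) → x ∈ ⁅ y ⁆ ∪ ⁅ z ⁆ → x ≡ y ⊎ x ≡ z
x∈⁅y⁆∪⁅z⁆⁻ y z x∈ with x∈p∪q⁻ ⁅ y ⁆ ⁅ z ⁆ x∈
... | inj₁ x∈⁅y⁆ = inj₁ (x∈⁅y⁆⇒x≡y y x∈⁅y⁆)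
... | inj₂ x∈⁅z⁆ = inj₂ (x∈⁅y⁆⇒x≡y z x∈⁅z⁆)

x∈p∧y∉p⇒x≢y : ∀ {y : Fin n} → x ∈ p → y ∉ p → x ≢ y
x∈p∧y∉p⇒x≢y x∈p y∉p refl = y∉p x∈p

x∈⁅x⁆∪p : ∀ (x : Fin n) p → x ∈ ⁅ x ⁆ ∪ p
x∈⁅x⁆∪p x p = x∈p∪q⁺ (inj₁ (x∈⁅x⁆ x))

p∪⁅v⁆∪⁅x⁆⊆⁅v⁆∪p : x ∈ p → p ∪ (⁅ v ⁆ ∪ ⁅ x ⁆) ⊆ ⁅ v ⁆ ∪ p
p∪⁅v⁆∪⁅x⁆⊆⁅v⁆∪p {p = p} {v = v} x∈p {y} y∈ with x∈p∪q⁻ p _ y∈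
... | inj₁ y∈p = x∈p∪q⁺ (inj₂ y∈p)
... | inj₂ y∈⁅v,x⁆ with x∈⁅y⁆∪⁅z⁆⁻ v _ y∈⁅v,x⁆
...   | inj₁ refl = x∈⁅x⁆∪p v p
...   | inj₂ refl = x∈p∪q⁺ (inj₂ x∈p)

T-not⁺ : ∀ {b} → ¬ T b → T (not b)
T-not⁺ {false} _  = tt
T-not⁺ {true}  ¬t = ¬t tt

T-not⁻ : ∀ {b} → T (not b) → ¬ T b
T-not⁻ {false} _ ()

mapOr : ∀ {A B : Set} → B → (A → B) → List A → List B
mapOr z f xs = if null xs then [ z ] else map f xs

∈-mapOr⁻ : ∀ {A B : Set} {z : B} {f : A → B} {y} xs → y ∈ₗ mapOr z f xs
         → (xs ≡ [] × y ≡ z) ⊎ ∃[ x ] x ∈ₗ xs × y ≡ f x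
∈-mapOr⁻ []      (here refl) = inj₁ (refl , refl)
∈-mapOr⁻ (_ ∷ _) y∈          = inj₂ (∈-map⁻ _ y∈)

∈-mapOr⁺ : ∀ {A B : Set} {z : B} {f : A → B} {x xs} → x ∈ₗ xs → f x ∈ₗ mapOr z f xs
∈-mapOr⁺ {xs = _ ∷ _} x∈ = ∈-map⁺ _ x∈

Covered : List (Subset n) → Subset n → Set
Covered av S = ∃[ B ] B ∈ₗ av × S ⊆ B

_⊑_ : List (Subset n) → List (Subset n) → Set
av ⊑ av′ = ∀ {B} → B ∈ₗ av → Covered av′ B

⊑-refl : ∀ {av : List (Subset n)} → av ⊑ av
⊑-refl {B = B} B∈ = B , B∈ , id

Covered-⊑ : ∀ {av av′ : List (Subset n)} {S} → Covered av S → av ⊑ av′ → Covered av′ S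
Covered-⊑ (B , B∈ , S⊆B) av⊑av′ with av⊑av′ B∈
... | B′ , B′∈ , B⊆B′ = B′ , B′∈ , B⊆B′ ∘ S⊆B

⊑-trans : ∀ {av av′ av″ : List (Subset n)} → av ⊑ av′ → av′ ⊑ av″ → av ⊑ av″
⊑-trans av⊑av′ av′⊑av″ B∈ = Covered-⊑ (av⊑av′ B∈) av′⊑av″

Covered-⊆ : ∀ {av : List (Subset n)} {S T} → S ⊆ T → Covered av T → Covered av S
Covered-⊆ S⊆T (B , B∈ , T⊆B) = B , B∈ , T⊆B ∘ S⊆T

⁅v⁆-covered : ∀ (av : List (Subset n)) → All (v ∈_) av → av ≡ [] ⊎ Covered av ⁅ v ⁆
⁅v⁆-covered []      _            = inj₁ refl
⁅v⁆-covered (B ∷ _) (v∈B ∷ _) = inj₂ (B , here refl , x∈p⇒⁅x⁆⊆p v∈B)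

module _ (G : SimpleGraph n) where

  isClique-⊆ : ∀ {S T} → S ⊆ T → IsClique G T → IsClique G S
  isClique-⊆ S⊆T T-clique u w u∈S w∈S = T-clique u w (S⊆T u∈S) (S⊆T w∈S)

  ⁅x⁆-isClique : ∀ x → IsClique G ⁅ x ⁆
  ⁅x⁆-isClique x u w u∈ w∈ u≢w = ⊥-elim (u≢w (trans (x∈⁅y⁆⇒x≡y x u∈) (sym (x∈⁅y⁆⇒x≡y x w∈))))

  ∈-nbr⁻ : ∀ R → x ∈ nbr G R v → adj G v x ≡ true × x ∈ R
  ∈-nbr⁻ {x = x} {v = v} R x∈N with x∈p∩q⁻ (tabulate (adj G v)) R x∈N
  ... | x∈row , x∈R = trans (sym (lookup∘tabulate (adj G v) x)) ([]=⇒lookup x∈row) , x∈R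

  ∈-nbr⁺ : ∀ R → adj G v x ≡ true → x ∈ R → x ∈ nbr G R v
  ∈-nbr⁺ {v = v} {x = x} R vx x∈R =
    x∈p∩q⁺ (lookup⇒[]= x (tabulate (adj G v)) (trans (lookup∘tabulate (adj G v) x) vx) , x∈R)

  isClique-⁅v⁆∪ : ∀ {C} R → IsClique G C → C ⊆ nbr G R v → IsClique G (⁅ v ⁆ ∪ C)
  isClique-⁅v⁆∪ {v = v} {C} R C-clique C⊆N u w u∈ w∈ u≢w with x∈p∪q⁻ ⁅ v ⁆ C u∈ | x∈p∪q⁻ ⁅ v ⁆ C w∈
  ... | inj₁ u∈⁅v⁆ | inj₁ w∈⁅v⁆ = ⊥-elim (u≢w (trans (x∈⁅y⁆⇒x≡y v u∈⁅v⁆) (sym (x∈⁅y⁆⇒x≡y v w∈⁅v⁆))))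
  ... | inj₁ u∈⁅v⁆ | inj₂ w∈C   rewrite x∈⁅y⁆⇒x≡y v u∈⁅v⁆ = proj₁ (∈-nbr⁻ R (C⊆N w∈C))
  ... | inj₂ u∈C   | inj₁ w∈⁅v⁆ rewrite x∈⁅y⁆⇒x≡y v w∈⁅v⁆ =
    trans (adj-sym G u v) (proj₁ (∈-nbr⁻ R (C⊆N u∈C)))
  ... | inj₂ u∈C   | inj₂ w∈C   = C-clique u w u∈C w∈C u≢w

  ∈-toSubset⁺ : ∀ {xs} → x ∈ₗ xs → x ∈ toSubset G xs
  ∈-toSubset⁺ {x = x} (here refl) = x∈⁅x⁆∪p x _
  ∈-toSubset⁺ (there x∈xs) = x∈p∪q⁺ (inj₂ (∈-toSubset⁺ x∈xs))

  ∈-toSubset⁻ : ∀ xs → x ∈ toSubset G xs → x ∈ₗ xs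
  ∈-toSubset⁻ []       x∈ = ⊥-elim (∉⊥ x∈)
  ∈-toSubset⁻ (y ∷ ys) x∈ with x∈p∪q⁻ ⁅ y ⁆ (toSubset G ys) x∈
  ... | inj₁ x∈⁅y⁆ = here (x∈⁅y⁆⇒x≡y y x∈⁅y⁆)
  ... | inj₂ x∈ys  = there (∈-toSubset⁻ ys x∈ys)

  module _ {L B : Subset n} where

    oldB⇒⊆ : T (oldB G L B) → L ⊆ B
    oldB⇒⊆ old with ∣ B ∣ <? ∣ L ∣ | L ⊆? B
    ... | no _ | yes L⊆B = L⊆B

    ⊆⇒oldB : L ⊆ B → T (oldB G L B)
    ⊆⇒oldB L⊆B with ∣ B ∣ <? ∣ L ∣ | L ⊆? B
    ... | no _   | yes _ = tt
    ... | _      | no L⊈B = ⊥-elim (L⊈B L⊆B)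
    ... | yes B<L | yes _ = ⊥-elim (<⇒≱ B<L (p⊆q⇒∣p∣≤∣q∣ L⊆B))

    ¬oldB⇒newB : ¬ T (oldB G L B) → T (newB G L B)
    ¬oldB⇒newB ¬old with ∣ B ∣ <? ∣ L ∣ | L ⊆? B
    ... | yes _ | _     = tt
    ... | no _  | no _  = tt
    ... | no _  | yes _ = ⊥-elim (¬old tt)

    removeB⇒⊂ : T (removeB G L B) → B ⊂ L
    removeB⇒⊂ remove with ∣ B ∣ <? ∣ L ∣ | ≡-dec Bool._≟_ B ⊥ | B ⊂? L
    ... | yes _ | no _ | yes B⊂L = B⊂L

    ⊂⇒removeB : x ∈ B → B ⊂ L → T (removeB G L B)
    ⊂⇒removeB x∈B B⊂L with ∣ B ∣ <? ∣ L ∣ | ≡-dec Bool._≟_ B ⊥ | B ⊂? L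
    ... | yes _ | no _    | yes _  = tt
    ... | no B≮L | _       | _      = ⊥-elim (B≮L (p⊂q⇒∣p∣<∣q∣ B⊂L))
    ... | _      | yes refl | _      = ⊥-elim (∉⊥ x∈B)
    ... | _      | _       | no B⊄L = ⊥-elim (B⊄L B⊂L)

    ¬removeB⇒⊇ : x ∈ B → ¬ T (removeB G L B) → B ⊆ L → L ⊆ B
    ¬removeB⇒⊇ x∈B kept B⊆L with L ⊆? B
    ... | yes L⊆B = L⊆B
    ... | no  L⊈B = ⊥-elim (kept (⊂⇒removeB x∈B (B⊆L , ⊈⇒∃∉ L⊈B)))

  scanned : List (Subset n) → List (Subset n)
  scanned av = if null av then ⊥ ∷ [] else av

  survivors : Subset n → List (Subset n) → List (Subset n)
  survivors L = filterᵇ (λ B → not (removeB G L B))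

  update-old : ∀ av L → T (any (oldB G L) (scanned av)) → update G av L ≡ survivors L av
  update-old av L old with any (newB G L) (scanned av) | any (oldB G L) (scanned av)
  ... | false | true  = refl
  ... | true  | true  = refl
  ... | _     | false = ⊥-elim old

  update-new : ∀ av L → T (any (newB G L) (scanned av)) → ¬ T (any (oldB G L) (scanned av))
             → update G av L ≡ survivors L av ++ [ L ]
  update-new av L new ¬old with any (newB G L) (scanned av) | any (oldB G L) (scanned av)
  ... | true  | false = refl
  ... | true  | true  = ⊥-elim (¬old tt)

  ∈-scanned⁻ : ∀ av {B} → B ∈ₗ scanned av → B ∈ₗ av ⊎ B ≡ ⊥
  ∈-scanned⁻ []      (here refl) = inj₂ refl
  ∈-scanned⁻ (_ ∷ _) B∈          = inj₁ B∈

  ∈-scanned⁺ : ∀ {av B} → B ∈ₗ av → B ∈ₗ scanned av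
  ∈-scanned⁺ {_ ∷ _} B∈ = B∈

  head-scanned : ∀ av → ∃[ B ] B ∈ₗ scanned av
  head-scanned []      = ⊥ , here refl
  head-scanned (B ∷ _) = B , here refl

  ¬old⇒new : ∀ av L → ¬ T (any (oldB G L) (scanned av)) → T (any (newB G L) (scanned av))
  ¬old⇒new av L ¬old with head-scanned av
  ... | B , B∈ = any⁺ (newB G L) (lose B∈ (¬oldB⇒newB {L} (¬old ∘ any⁺ (oldB G L) ∘ lose B∈)))

module _ (G : SimpleGraph n) (v : Fin n) where

  Member : Subset n → Set
  Member S = IsClique G S × v ∈ S

  Incomparable : Subset n → Subset n → Set
  Incomparable S T = (v ∈ S × v ∈ T) × (S ⊈ T × T ⊈ S)

  WellFormed : List (Subset n) → Set
  WellFormed av = All Member av × AllPairs Incomparable av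

  survivors-wellFormed : ∀ {av} L → WellFormed av → WellFormed (survivors G L av)
  survivors-wellFormed L (members , incomparable) =
    All.filter⁺ (T? ∘ _) members , AllPairs.filter⁺ (T? ∘ _) incomparable

  survivors-⊑ : ∀ {av av′} L → (∀ {B} → B ∈ₗ survivors G L av → B ∈ₗ av′) → Covered av′ L → av ⊑ av′
  survivors-⊑ L survivors⊆av′ (B′ , B′∈ , L⊆B′) {B} B∈ with T? (removeB G L B)
  ... | yes removed = B′ , B′∈ , L⊆B′ ∘ proj₁ (removeB⇒⊂ G removed)
  ... | no  kept    = B , survivors⊆av′ (∈-filter⁺ (T? ∘ _) B∈ (T-not⁺ kept)) , id

  update-spec : ∀ av L → WellFormed av → Member L
              → WellFormed (update G av L) × Covered (update G av L) L × av ⊑ update G av L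
  update-spec av L wf@(members , incomparable) L-member@(_ , v∈L) with T? (any (oldB G L) (scanned G av))
  ... | yes old with find (any⁻ (oldB G L) _ old)
  ...   | B , B∈ , B-old with ∈-scanned⁻ G av B∈
  ...     | inj₂ refl = ⊥-elim (∉⊥ (oldB⇒⊆ G B-old v∈L))
  ...     | inj₁ B∈av rewrite update-old G av L old =
    survivors-wellFormed L wf , L-covered , survivors-⊑ L id L-covered
    where
    B-kept : ¬ T (removeB G L B)
    B-kept remove with removeB⇒⊂ G {L} remove
    ... | _ , x , x∈L , x∉B = x∉B (oldB⇒⊆ G B-old x∈L)

    L-covered : Covered (survivors G L av) L
    L-covered = B , ∈-filter⁺ (T? ∘ _) B∈av (T-not⁺ B-kept) , oldB⇒⊆ G B-old
  update-spec av L wf@(members , incomparable) L-member@(_ , v∈L) | no ¬old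
    rewrite update-new G av L (¬old⇒new G av L ¬old) ¬old =
    (All.++⁺ (All.filter⁺ (T? ∘ _) members) (L-member ∷ []) ,
     AllPairs.++⁺ (AllPairs.filter⁺ (T? ∘ _) incomparable) ([] ∷ [])
                  (All.tabulate λ B∈ → incomparable-L B∈ ∷ [])) ,
    L-covered , survivors-⊑ L ∈-++⁺ˡ L-covered
    where
    ¬oldB : ∀ {B} → B ∈ₗ scanned G av → ¬ T (oldB G L B)
    ¬oldB B∈ = ¬old ∘ any⁺ (oldB G L) ∘ lose B∈

    L-covered : Covered (survivors G L av ++ [ L ]) L
    L-covered = L , ∈-++⁺ʳ (survivors G L av) (here refl) , id

    incomparable-L : ∀ {B} → B ∈ₗ survivors G L av → Incomparable B L
    incomparable-L {B} B∈ with ∈-filter⁻ (T? ∘ _) {xs = av} B∈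
    ... | B∈av , kept = (v∈B , v∈L) , B⊈L , L⊈B
      where
      v∈B : v ∈ B
      v∈B = proj₂ (All.lookup members B∈av)
      L⊈B : L ⊈ B
      L⊈B L⊆B = ¬oldB (∈-scanned⁺ G B∈av) (⊆⇒oldB G L⊆B)
      B⊈L : B ⊈ L
      B⊈L = L⊈B ∘ ¬removeB⇒⊇ G v∈B (T-not⁻ kept)

  foldl-update-spec : ∀ acc cs → WellFormed acc → All Member cs
    → WellFormed (foldl (update G) acc cs) × All (Covered (foldl (update G) acc cs)) cs
      × acc ⊑ foldl (update G) acc cs
  foldl-update-spec acc []       wf []                  = wf , [] , ⊑-refl
  foldl-update-spec acc (c ∷ cs) wf (c-member ∷ members)
    with update-spec acc c wf c-member
  ... | wf′ , c-covered , acc⊑acc′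
    with foldl-update-spec (update G acc c) cs wf′ members
  ... | wf″ , cs-covered , acc′⊑acc″ =
    wf″ , Covered-⊑ c-covered acc′⊑acc″ ∷ cs-covered , ⊑-trans acc⊑acc′ acc′⊑acc″

CoveredAtOwnVertex : (Fin n → List (Subset n)) → Subset n → Set
CoveredAtOwnVertex a K = ∃[ z ] z ∈ K × Covered (a z) K

module FC₂-correct (G : SimpleGraph n) (iter : Fin n → List (Fin n))
                   (iter-complete : ∀ v x → x ∈ₗ iter v) where

  -- The second alternative is needed: an isolated vertex x keeps a_x empty.
  record Invariant (vs : List (Fin n)) : Set where
    field
      wellFormed : ∀ u → WellFormed G u (FC₂ G vs iter u)
      covering   : ∀ K → IsClique G K → K ⊆ toSubset G vs → ∀ {x} → x ∈ K
                 → CoveredAtOwnVertex (FC₂ G vs iter) K ⊎ (FC₂ G vs iter x ≡ [] × K ⊆ ⁅ x ⁆)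

  invariant-[] : Invariant []
  invariant-[] = record
    { wellFormed = λ _ → [] , []
    ; covering   = λ _ _ K⊆⊥ x∈K → ⊥-elim (∉⊥ (K⊆⊥ x∈K))
    }

  module Step (v : Fin n) (vs : List (Fin n)) where

    a : Fin n → List (Subset n)
    a = FC₂ G vs iter

    R : Subset n
    R = toSubset G (v ∷ vs)

    N : Subset n
    N = nbr G R v

    M : List (Fin n)
    M = filterᵇ (lookup N) (iter v)

    extension : Fin n → Subset n → Subset n
    extension x A = (N ∩ A) ∪ (⁅ v ⁆ ∪ ⁅ x ⁆)

    candidates : Fin n → List (Subset n)
    candidates x = mapOr (⁅ v ⁆ ∪ ⁅ x ⁆) (extension x) (a x)

    stored : List (Subset n)
    stored = foldl (update G) [] (concatMap candidates M)

    FC₂-∷-self : FC₂ G (v ∷ vs) iter v ≡ stored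
    FC₂-∷-self with v ≟ v
    ... | yes _   = refl
    ... | no v≢v = ⊥-elim (v≢v refl)

    FC₂-∷-other : ∀ {u} → u ≢ v → FC₂ G (v ∷ vs) iter u ≡ a u
    FC₂-∷-other {u} u≢v with u ≟ v
    ... | yes u≡v = ⊥-elim (u≢v u≡v)
    ... | no _    = refl

    stored-covered : ∀ {K} → v ∈ K → Covered stored K → CoveredAtOwnVertex (FC₂ G (v ∷ vs) iter) K
    stored-covered {K} v∈K K-covered = v , v∈K , subst (λ av → Covered av K) (sym FC₂-∷-self) K-covered

    ∈-M⁺ : x ∈ N → x ∈ₗ M
    ∈-M⁺ {x} x∈N = ∈-filter⁺ (T? ∘ lookup N) (iter-complete v x)
                     (Equivalence.from T-≡ ([]=⇒lookup x∈N))

    ∈-M⁻ : x ∈ₗ M → x ∈ N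
    ∈-M⁻ {x} x∈M =
      lookup⇒[]= x N (Equivalence.to T-≡ (proj₂ (∈-filter⁻ (T? ∘ lookup N) {xs = iter v} x∈M)))

    ∈-R-tail : ∀ {w} → w ∈ R → w ≢ v → w ∈ toSubset G vs
    ∈-R-tail w∈R w≢v with ∈-toSubset⁻ G (v ∷ vs) w∈R
    ... | here w≡v    = ⊥-elim (w≢v w≡v)
    ... | there w∈vs = ∈-toSubset⁺ G w∈vs

    module _ (v∉vs : ¬ v ∈ₗ vs) (inv : Invariant vs) where
      open Invariant inv

      candidate-member : ∀ {x L} → x ∈ₗ M → L ∈ₗ candidates x → Member G v L
      candidate-member {x} x∈M L∈ with ∈-M⁻ x∈M | ∈-mapOr⁻ (a x) L∈
      ... | x∈N | inj₁ (_ , refl) =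
        isClique-⁅v⁆∪ G R (⁅x⁆-isClique G x) (x∈p⇒⁅x⁆⊆p x∈N) , x∈⁅x⁆∪p v _
      ... | x∈N | inj₂ (A , A∈ , refl) with All.lookup (proj₁ (wellFormed x)) A∈
      ...   | A-clique , x∈A =
        isClique-⊆ G (p∪⁅v⁆∪⁅x⁆⊆⁅v⁆∪p (x∈p∩q⁺ (x∈N , x∈A)))
          (isClique-⁅v⁆∪ G R (isClique-⊆ G (p∩q⊆q N A) A-clique) (p∩q⊆p N A)) ,
        x∈p∪q⁺ (inj₂ (x∈⁅x⁆∪p v _))

      stored-spec : WellFormed G v stored × All (Covered stored) (concatMap candidates M)
      stored-spec =
        let wf , covered , _ = foldl-update-spec G v [] _ ([] , []) (All.tabulate member) in wf , covered
        where
        member : ∀ {L} → L ∈ₗ concatMap candidates M → Member G v L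
        member L∈ with find (∈-concatMap⁻ candidates {xs = M} L∈)
        ... | x , x∈M , L∈′ = candidate-member x∈M L∈′

      candidate-covered : ∀ {x L} → x ∈ₗ M → L ∈ₗ candidates x → Covered stored L
      candidate-covered x∈M L∈ = All.lookup (proj₂ stored-spec) (∈-concatMap⁺ candidates (lose x∈M L∈))

      module _ {K} (K-clique : IsClique G K) (K⊆R : K ⊆ R) (v∈K : v ∈ K) where

        K′ : Subset n
        K′ = K ∩ toSubset G vs

        ∈-K′ : ∀ {w} → w ∈ K → w ≢ v → w ∈ K′
        ∈-K′ w∈K w≢v = x∈p∩q⁺ (w∈K , ∈-R-tail (K⊆R w∈K) w≢v)

        ∈-N : ∀ {w} → w ∈ K → w ≢ v → w ∈ N
        ∈-N {w} w∈K w≢v = ∈-nbr⁺ G R (K-clique v w v∈K w∈K (w≢v ∘ sym)) (K⊆R w∈K)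

        K′∌v : ∀ {w} → w ∈ K′ → w ≢ v
        K′∌v w∈K′ refl = v∉vs (∈-toSubset⁻ G vs (p∩q⊆q K _ w∈K′))

        K′⊆⇒K⊆ : ∀ {S} → v ∈ S → K′ ⊆ S → K ⊆ S
        K′⊆⇒K⊆ v∈S K′⊆S {w} w∈K with w ≟ v
        ... | yes refl = v∈S
        ... | no w≢v  = K′⊆S (∈-K′ w∈K w≢v)

        candidate-⊇ : ∀ {y} → y ∈ K′ → ∃[ x ] x ∈ₗ M × ∃[ L ] L ∈ₗ candidates x × K ⊆ L
        candidate-⊇ {y} y∈K′ with covering K′ (isClique-⊆ G (p∩q⊆p K _) K-clique) (p∩q⊆q K _) y∈K′
        ... | inj₁ (z , z∈K′ , A , A∈ , K′⊆A) =
          z , ∈-M⁺ (∈-N′ z∈K′) , extension z A , ∈-mapOr⁺ A∈ ,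
          K′⊆⇒K⊆ (x∈p∪q⁺ (inj₂ (x∈⁅x⁆∪p v _)))
                 (λ w∈K′ → x∈p∪q⁺ (inj₁ (x∈p∩q⁺ (∈-N′ w∈K′ , K′⊆A w∈K′))))
          where
          ∈-N′ : ∀ {w} → w ∈ K′ → w ∈ N
          ∈-N′ w∈K′ = ∈-N (p∩q⊆p K _ w∈K′) (K′∌v w∈K′)
        ... | inj₂ (ay≡[] , K′⊆⁅y⁆) =
          y , ∈-M⁺ (∈-N (p∩q⊆p K _ y∈K′) (K′∌v y∈K′)) , ⁅ v ⁆ ∪ ⁅ y ⁆ ,
          subst (λ l → ⁅ v ⁆ ∪ ⁅ y ⁆ ∈ₗ mapOr _ (extension y) l) (sym ay≡[]) (here refl) ,
          K′⊆⇒K⊆ (x∈⁅x⁆∪p v _) (x∈p∪q⁺ ∘ inj₂ ∘ K′⊆⁅y⁆)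

        K-covered : ∀ {y} → y ∈ K → y ≢ v → Covered stored K
        K-covered y∈K y≢v with candidate-⊇ (∈-K′ y∈K y≢v)
        ... | x , x∈M , L , L∈ , K⊆L = Covered-⊆ K⊆L (candidate-covered x∈M L∈)

      invariant-∷ : Invariant (v ∷ vs)
      invariant-∷ = record { wellFormed = wellFormed′ ; covering = covering′ }
        where
        wellFormed′ : ∀ u → WellFormed G u (FC₂ G (v ∷ vs) iter u)
        wellFormed′ u with u ≟ v
        ... | yes refl = proj₁ stored-spec
        ... | no _     = wellFormed u

        covering′ : ∀ K → IsClique G K → K ⊆ R → ∀ {x} → x ∈ K
                  → CoveredAtOwnVertex (FC₂ G (v ∷ vs) iter) K ⊎ (FC₂ G (v ∷ vs) iter x ≡ [] × K ⊆ ⁅ x ⁆)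
        covering′ K K-clique K⊆R {x} x∈K with v ∈? K
        ... | no v∉K with covering K K-clique (λ w∈K → ∈-R-tail (K⊆R w∈K) (x∈p∧y∉p⇒x≢y w∈K v∉K)) x∈K
        ...   | inj₁ (z , z∈K , z-covered) =
          inj₁ (z , z∈K , subst (λ av → Covered av K) (sym (FC₂-∷-other (x∈p∧y∉p⇒x≢y z∈K v∉K))) z-covered)
        ...   | inj₂ (ax≡[] , K⊆⁅x⁆) =
          inj₂ (trans (FC₂-∷-other (x∈p∧y∉p⇒x≢y x∈K v∉K)) ax≡[] , K⊆⁅x⁆)
        covering′ K K-clique K⊆R {x} x∈K | yes v∈K with K ⊆? ⁅ v ⁆
        ... | no K⊈⁅v⁆ with ⊈⇒∃∉ K⊈⁅v⁆
        ...   | y , y∈K , y∉⁅v⁆ =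
          inj₁ (stored-covered v∈K (K-covered K-clique K⊆R v∈K y∈K (x∉⁅y⁆⇒x≢y y∉⁅v⁆)))
        covering′ K K-clique K⊆R {x} x∈K | yes v∈K | yes K⊆⁅v⁆
          rewrite x∈⁅y⁆⇒x≡y v (K⊆⁅v⁆ x∈K) | FC₂-∷-self
          with ⁅v⁆-covered stored (All.map proj₂ (proj₁ (proj₁ stored-spec)))
        ... | inj₁ stored≡[]   = inj₂ (stored≡[] , K⊆⁅v⁆)
        ... | inj₂ ⁅v⁆-covered = inj₁ (stored-covered v∈K (Covered-⊆ K⊆⁅v⁆ ⁅v⁆-covered))

  invariant : ∀ vs → AllPairs _≢_ vs → Invariant vs
  invariant []       []              = invariant-[]
  invariant (v ∷ vs) (v≢vs ∷ unique) =
    Step.invariant-∷ v vs (λ v∈vs → All.lookup v≢vs v∈vs refl) (invariant vs unique)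

  largest-isMaximumClique : ∀ {vs} → Invariant vs → (∀ x → x ∈ₗ vs)
    → ∀ v S → S ∈ₗ FC₂ G vs iter v → (∀ u T → T ∈ₗ FC₂ G vs iter u → ∣ T ∣ ≤ ∣ S ∣)
    → IsMaximumClique G S
  largest-isMaximumClique {vs} inv vs-complete v S S∈ largest = proj₁ S-member , bounded
    where
    open Invariant inv
    S-member : Member G v S
    S-member = All.lookup (proj₁ (wellFormed v)) S∈

    bounded : ∀ T → IsClique G T → ∣ T ∣ ≤ ∣ S ∣
    bounded T T-clique with nonempty? T
    ... | no T-empty = p⊆q⇒∣p∣≤∣q∣ {q = S} (λ x∈T → ⊥-elim (T-empty (_ , x∈T)))
    ... | yes (x , x∈T) with covering T T-clique (λ {y} _ → ∈-toSubset⁺ G (vs-complete y)) x∈T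
    ...   | inj₁ (z , _ , B , B∈ , T⊆B) = ≤-trans (p⊆q⇒∣p∣≤∣q∣ T⊆B) (largest z B B∈)
    ...   | inj₂ (_ , T⊆⁅x⁆) = begin
      ∣ T ∣     ≤⟨ p⊆q⇒∣p∣≤∣q∣ T⊆⁅x⁆ ⟩
      ∣ ⁅ x ⁆ ∣ ≡⟨ trans (∣⁅x⁆∣≡1 x) (sym (∣⁅x⁆∣≡1 v)) ⟩
      ∣ ⁅ v ⁆ ∣ ≤⟨ p⊆q⇒∣p∣≤∣q∣ (x∈p⇒⁅x⁆⊆p (proj₂ S-member)) ⟩
      ∣ S ∣     ∎
      where open ≤-Reasoning

theorem2 : ∀ {n : ℕ} (G : SimpleGraph n) (order : List (Fin n)) (iter : Fin n → List (Fin n))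
    → order ↭ allFin n
    → (∀ v → iter v ↭ allFin n)
    → (∀ v → All (λ S → IsClique G S × v ∈ S) (FC₂ G order iter v)
             × AllPairs (λ S T → (v ∈ S × v ∈ T) × (S ⊈ T × T ⊈ S)) (FC₂ G order iter v))
      × (∀ v S → S ∈ₗ FC₂ G order iter v
           → (∀ u T → T ∈ₗ FC₂ G order iter u → ∣ T ∣ ≤ ∣ S ∣)
           → IsMaximumClique G S)
theorem2 G order iter order↭ iter↭ = wellFormed , largest-isMaximumClique inv order-complete
  where
  order-complete : ∀ x → x ∈ₗ order
  order-complete x = ∈-resp-↭ (↭-sym order↭) (∈-allFin x)

  open FC₂-correct G iter (λ v x → ∈-resp-↭ (↭-sym (iter↭ v)) (∈-allFin x))

  inv : Invariant order
  inv = invariant order (Permutation.Unique-resp-↭ (setoid _) (↭⇒↭ₛ (↭-sym order↭)) (allFin⁺ _))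

  open Invariant inv
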